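{- For every fixed $q\in\mathbb{N}$, $c_{p,q}=O\!\left(\frac{1}{q!}p^{2q}\right)$ as $p\to\infty$.
   Context: $c_{p,q}$ is the number of $B$-orbits on $Sp_{2p}/(Sp_{2q}\times Sp_{2p-2q})$ over an algebraically closed field of characteristic $\ne2$ ($B$ a Borel subgroup), which equals the number of $q$-matchings (sets of $q$ pairwise vertex-disjoint edges) in the double corona graph $C^{(2)}_p$: vertices $v_1,\dots,v_p,w_1,\dots,w_p$, two parallel edges between $v_i$ and $v_j$ for each $i\ne j$, and one edge $v_iw_i$ for each $i$. -}

module Defs where

open import Data.Bool using (Bool; true; false; _∧_; not)
open import Data.Nat using (ℕ; zero; suc; _≡ᵇ_)
open import Data.Product using (_×_; _,_)
open import Data.List using (List; []; _∷_; _++_; map; concatMap; upTo; length; filter)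
open import Data.Bool.ListAction using (all)
open import Data.Bool using (if_then_else_)
open import Relation.Nullary.Decidable using (Dec)
open import Data.Bool.Properties using (T?)

-- Vertices of the double corona graph C⁽²⁾_p :
--   (false , i) is v_i  and  (true , i) is w_i   (0 ≤ i < p)
Vertex : Set
Vertex = Bool × ℕ

v w : ℕ → Vertex
v i = (false , i)
w i = (true , i)

-- An edge is given by its two endpoints.  Parallel edges are distinct
-- entries of the edge list.
Edge : Set
Edge = Vertex × Vertex

vvEdges : ℕ → List Edge
vvEdges p = concatMap (λ j → concatMap (λ i → (v i , v j) ∷ (v i , v j) ∷ []) (upTo j)) (upTo p)

vwEdges : ℕ → List Edge
vwEdges p = map (λ i → (v i , w i)) (upTo p)

edges : ℕ → List Edge
edges p = vvEdges p ++ vwEdges p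

_==B_ : Bool → Bool → Bool
true ==B true = true
false ==B false = true
_ ==B _ = false

sameVertex : Vertex → Vertex → Bool
sameVertex (a , i) (b , j) = (a ==B b) ∧ (i ≡ᵇ j)

disjoint : Edge → Edge → Bool
disjoint (a , b) (c , d) =
  not (sameVertex a c) ∧ not (sameVertex a d) ∧ not (sameVertex b c) ∧ not (sameVertex b d)

pairwiseDisjoint : List Edge → Bool
pairwiseDisjoint [] = true
pairwiseDisjoint (e ∷ es) = all (disjoint e) es ∧ pairwiseDisjoint es

-- all sub-lists (chosen by position) of length k: these are exactly the
-- k-element subsets of the list's entries
subsets : {A : Set} → List A → ℕ → List (List A)
subsets xs zero = [] ∷ []
subsets [] (suc k) = []
subsets (x ∷ xs) (suc k) = map (x ∷_) (subsets xs k) ++ subsets xs (suc k)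

c : ℕ → ℕ → ℕ
c p q = length (filter (λ m → T? (pairwiseDisjoint m)) (subsets (edges p) q))

-- A q-matching is in particular a q-element set of edges, and C⁽²⁾_p has
-- p (p - 1) + p = p² edges; so q! c_{p,q} ≤ q! (p² choose q) ≤ p^{2q}, the last
-- step being the bound k! (n choose k) ≤ n^k, proved via Pascal's rule and the
-- binomial estimate nᵏ⁺¹ + (k+1) nᵏ ≤ (n+1)ᵏ⁺¹.
module Submission where

open import Defs
open import Data.Nat using (ℕ; zero; suc; _+_; _≤_; _*_; _^_; _!)
open import Data.Nat.Properties
open import Data.Nat.Tactic.RingSolver using (solve-∀)
open import Data.Product using (∃-syntax; _,_)
open import Data.List using (List; []; _∷_; _++_; _∷ʳ_; map; concatMap; upTo; length)
open import Data.List.Properties using (length-++; ++-identityʳ; length-map; length-upTo; upTo-∷ʳ; concatMap-++; length-filter)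
open import Data.Bool.Properties using (T?)
open import Relation.Binary.PropositionalEquality using (_≡_; refl; cong; cong₂; sym; module ≡-Reasoning)

n^[1+k]+[1+k]*n^k≤[1+n]^[1+k] : ∀ n k → n ^ suc k + suc k * n ^ k ≤ suc n ^ suc k
n^[1+k]+[1+k]*n^k≤[1+n]^[1+k] n zero = ≤-reflexive (+-comm (n * 1) 1)
n^[1+k]+[1+k]*n^k≤[1+n]^[1+k] n (suc k) = begin
  n ^ suc (suc k) + suc (suc k) * n ^ suc k                   ≤⟨ m≤m+n _ (suc k * n ^ k) ⟩
  n ^ suc (suc k) + suc (suc k) * n ^ suc k + suc k * n ^ k   ≡⟨ factor n k (n ^ k) ⟩
  suc n * (n ^ suc k + suc k * n ^ k)                         ≤⟨ *-monoʳ-≤ (suc n) (n^[1+k]+[1+k]*n^k≤[1+n]^[1+k] n k) ⟩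
  suc n ^ suc (suc k)                                         ∎
  where
  open ≤-Reasoning
  factor : ∀ n k a → n * (n * a) + (2 + k) * (n * a) + (1 + k) * a ≡ (1 + n) * (n * a + (1 + k) * a)
  factor = solve-∀

k!*length-subsets≤length^k : ∀ {A : Set} (xs : List A) k → k ! * length (subsets xs k) ≤ length xs ^ k
k!*length-subsets≤length^k xs       zero    = ≤-refl
k!*length-subsets≤length^k []       (suc k) = ≤-reflexive (*-zeroʳ (suc k !))
k!*length-subsets≤length^k (x ∷ xs) (suc k) = begin
  suc k ! * length (map (x ∷_) (subsets xs k) ++ subsets xs (suc k))
    ≡⟨ cong (suc k ! *_) length-pascal ⟩
  (suc k * k !) * (length (subsets xs k) + length (subsets xs (suc k)))
    ≡⟨ distribute (suc k) (k !) (length (subsets xs k)) (length (subsets xs (suc k))) ⟩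
  suc k * (k ! * length (subsets xs k)) + suc k ! * length (subsets xs (suc k))
    ≤⟨ +-mono-≤ (*-monoʳ-≤ (suc k) (k!*length-subsets≤length^k xs k)) (k!*length-subsets≤length^k xs (suc k)) ⟩
  suc k * length xs ^ k + length xs ^ suc k
    ≡⟨ +-comm (suc k * length xs ^ k) (length xs ^ suc k) ⟩
  length xs ^ suc k + suc k * length xs ^ k
    ≤⟨ n^[1+k]+[1+k]*n^k≤[1+n]^[1+k] (length xs) k ⟩
  suc (length xs) ^ suc k ∎
  where
  open ≤-Reasoning
  length-pascal : length (map (x ∷_) (subsets xs k) ++ subsets xs (suc k))
                ≡ length (subsets xs k) + length (subsets xs (suc k))
  length-pascal rewrite length-++ (map (x ∷_) (subsets xs k)) {subsets xs (suc k)}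
                      | length-map (x ∷_) (subsets xs k) = refl
  distribute : ∀ m f a b → (m * f) * (a + b) ≡ m * (f * a) + (m * f) * b
  distribute = solve-∀

length-concatMap-const : ∀ {A B : Set} (f : A → List B) k → (∀ x → length (f x) ≡ k) →
                         ∀ xs → length (concatMap f xs) ≡ length xs * k
length-concatMap-const f k ∣f∣≡k []       = refl
length-concatMap-const f k ∣f∣≡k (x ∷ xs) = begin
  length (f x ++ concatMap f xs)           ≡⟨ length-++ (f x) ⟩
  length (f x) + length (concatMap f xs)   ≡⟨ cong₂ _+_ (∣f∣≡k x) (length-concatMap-const f k ∣f∣≡k xs) ⟩
  k + length xs * k                        ∎
  where open ≡-Reasoning

length-vvEdges-suc : ∀ p → length (vvEdges (suc p)) ≡ length (vvEdges p) + p * 2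
length-vvEdges-suc p = begin
  length (concatMap edgesBelow (upTo (suc p)))
    ≡⟨ cong (λ js → length (concatMap edgesBelow js)) (sym (upTo-∷ʳ p)) ⟩
  length (concatMap edgesBelow (upTo p ∷ʳ p))
    ≡⟨ cong length (concatMap-++ edgesBelow (upTo p) (p ∷ [])) ⟩
  length (vvEdges p ++ edgesBelow p ++ [])
    ≡⟨ length-++ (vvEdges p) ⟩
  length (vvEdges p) + length (edgesBelow p ++ [])
    ≡⟨ cong (length (vvEdges p) +_) (cong length (++-identityʳ (edgesBelow p))) ⟩
  length (vvEdges p) + length (edgesBelow p)
    ≡⟨ cong (length (vvEdges p) +_) (length-concatMap-const _ 2 (λ _ → refl) (upTo p)) ⟩
  length (vvEdges p) + length (upTo p) * 2
    ≡⟨ cong (λ n → length (vvEdges p) + n * 2) (length-upTo p) ⟩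
  length (vvEdges p) + p * 2 ∎
  where
  open ≡-Reasoning
  edgesBelow : ℕ → List Edge
  edgesBelow j = concatMap (λ i → (v i , v j) ∷ (v i , v j) ∷ []) (upTo j)

length-vvEdges+p≡p*p : ∀ p → length (vvEdges p) + p ≡ p * p
length-vvEdges+p≡p*p zero    = refl
length-vvEdges+p≡p*p (suc p) = begin
  length (vvEdges (suc p)) + suc p        ≡⟨ cong (_+ suc p) (length-vvEdges-suc p) ⟩
  length (vvEdges p) + p * 2 + suc p      ≡⟨ regroup (length (vvEdges p)) p ⟩
  (length (vvEdges p) + p) + p + suc p    ≡⟨ cong (λ n → n + p + suc p) (length-vvEdges+p≡p*p p) ⟩
  p * p + p + suc p                       ≡⟨ square-suc p ⟩
  suc p * suc p                           ∎
  where
  open ≡-Reasoning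
  regroup : ∀ m p → m + p * 2 + (1 + p) ≡ m + p + p + (1 + p)
  regroup = solve-∀
  square-suc : ∀ p → p * p + p + (1 + p) ≡ (1 + p) * (1 + p)
  square-suc = solve-∀

length-edges : ∀ p → length (edges p) ≡ p * p
length-edges p = begin
  length (vvEdges p ++ vwEdges p)           ≡⟨ length-++ (vvEdges p) ⟩
  length (vvEdges p) + length (vwEdges p)   ≡⟨ cong (length (vvEdges p) +_) (length-map _ (upTo p)) ⟩
  length (vvEdges p) + length (upTo p)      ≡⟨ cong (length (vvEdges p) +_) (length-upTo p) ⟩
  length (vvEdges p) + p                    ≡⟨ length-vvEdges+p≡p*p p ⟩
  p * p                                     ∎
  where open ≡-Reasoning

[m*m]^n≡m^[2*n] : ∀ m n → (m * m) ^ n ≡ m ^ (2 * n)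
[m*m]^n≡m^[2*n] m n = begin
  (m * m) ^ n         ≡⟨ cong (λ k → (m * k) ^ n) (sym (*-identityʳ m)) ⟩
  (m ^ 2) ^ n         ≡⟨ ^-*-assoc m 2 n ⟩
  m ^ (2 * n)         ∎
  where open ≡-Reasoning

lemma6p3 : ∀ (q : ℕ) → ∃[ C ] ∃[ N ] (∀ (p : ℕ) → N ≤ p → (q !) * c p q ≤ C * p ^ (2 * q))
lemma6p3 q = 1 , 0 , λ p _ → begin
  q ! * c p q                           ≤⟨ *-monoʳ-≤ (q !) (length-filter (λ m → T? (pairwiseDisjoint m)) (subsets (edges p) q)) ⟩
  q ! * length (subsets (edges p) q)    ≤⟨ k!*length-subsets≤length^k (edges p) q ⟩
  length (edges p) ^ q                  ≡⟨ cong (_^ q) (length-edges p) ⟩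
  (p * p) ^ q                           ≡⟨ [m*m]^n≡m^[2*n] p q ⟩
  p ^ (2 * q)                           ≡⟨ sym (*-identityˡ (p ^ (2 * q))) ⟩
  1 * p ^ (2 * q)                       ∎
  where open ≤-Reasoning
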